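{- For any argument filtering function $\pi$ and any term $t\in\mathcal T$, $\pi(t)$ is well-typed under the typing function $type_\pi$, and $type_\pi(\pi(t))=type(t)$.
   Context: Setting: HRSs à la Nipkow. Simple types are generated from a set $\mathcal B$ of basic types by $\to$. $\mathcal T$ is the set of simply-typed $\lambda$-terms over typed variables $\mathcal V$ and typed function symbols $\Sigma$ in $\beta$-normal $\eta$-long form; every term has the form $\lambda x_1\ldots x_m.a(t_1,\ldots,t_n)$ with $a\in\Sigma\cup\mathcal V$; $type$ gives the type of symbols and terms. An argument filtering function $\pi$ assigns to every $f\in\Sigma$ of type $\alpha_1\to\cdots\to\alpha_n\to\beta$ with $\beta\in\mathcal B$ either a positive integer $i\le n$ such that $\alpha_i=\beta$, or a list $[i_1,\ldots,i_k]$ of positive integers with $i_1,\ldots,i_k\le n$. It is extended to terms by: $\pi(\lambda x_1\ldots x_m.a(t_1,\ldots,t_n))\equiv\lambda x_1\ldots x_m.\pi(t_i)$ if $a\in\Sigma$ and $\pi(a)=i$; $\equiv\lambda x_1\ldots x_m.a(\pi(t_{i_1}),\ldots,\pi(t_{i_k}))$ if $a\in\Sigma$ and $\pi(a)=[i_1,\ldots,i_k]$; $\equiv\lambda x_1\ldots x_m.a(\pi(t_1),\ldots,\pi(t_n))$ if $a\in\mathcal V$. The typing function after filtering is $type_\pi(a)=\alpha_{i_1}\to\cdots\to\alpha_{i_k}\to\beta$ if $a\in\Sigma$, $\pi(a)=[i_1,\ldots,i_k]$ and $type(a)=\alpha_1\to\cdots\to\alpha_n\to\beta$ with $\beta\in\mathcal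 B$; otherwise $type_\pi(a)=type(a)$. -}

module Defs where

open import Data.Nat using (ℕ; zero; suc)
open import Data.Fin using (Fin; toℕ)
open import Data.List using (List; []; _∷_; length; lookup; map; mapMaybe; _++_)
open import Data.Maybe using (Maybe; just; nothing)
open import Relation.Binary.PropositionalEquality using (_≡_)

data Ty (B : Set) : Set where
  base : B → Ty B
  _⇒_  : Ty B → Ty B → Ty B

infixr 5 _⇒_

arrows : {B : Set} → List (Ty B) → Ty B → Ty B
arrows []       β = β
arrows (α ∷ αs) β = α ⇒ arrows αs β

argTys : {B : Set} → Ty B → List (Ty B)
argTys (base b) = []
argTys (α ⇒ β)  = α ∷ argTys β

target : {B : Set} → Ty B → B
target (base b) = b
target (α ⇒ β)  = target β

-- The value π(f) for a symbol f of type τ = α₁ → ⋯ → αₙ → β.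
-- Positive integers i ≤ n are represented by Fin n (0-based: Fin index k is the paper's k+1).
data AF {B : Set} (τ : Ty B) : Set where
  proj : (i : Fin (length (argTys τ))) → lookup (argTys τ) i ≡ base (target τ) → AF τ
  keep : List (Fin (length (argTys τ))) → AF τ

nth : {A : Set} → List A → ℕ → Maybe A
nth []       _       = nothing
nth (x ∷ xs) zero    = just x
nth (x ∷ xs) (suc n) = nth xs n

module HRS {B Sig V : Set} (typeV : V → Ty B) where

  data Head : Set where
    var : V → Head
    fun : Sig → Head

  -- λ x₁ … xₘ . a(t₁,…,tₙ)
  data Tm : Set where
    tm : List V → Head → List Tm → Tm

  headTy : (Sig → Ty B) → Head → Ty B
  headTy τ (var x) = typeV x
  headTy τ (fun f) = τ f

  -- Typing of β-normal η-long terms w.r.t. a typing function τ for symbols: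
  -- λx₁…xₘ.a(t₁,…,tₙ) : type(x₁)→⋯→type(xₘ)→b  when
  -- type(a) = α₁→⋯→αₙ→b (b basic) and tᵢ : αᵢ.
  mutual
    data _⊢_∶_ (τ : Sig → Ty B) : Tm → Ty B → Set where
      tm-ty : ∀ {xs a ts αs b} → τ ⊢* ts ∶ αs → headTy τ a ≡ arrows αs (base b)
            → τ ⊢ tm xs a ts ∶ arrows (map typeV xs) (base b)

    data _⊢*_∶_ (τ : Sig → Ty B) : List Tm → List (Ty B) → Set where
      []  : τ ⊢* [] ∶ []
      _∷_ : ∀ {t ts α αs} → τ ⊢ t ∶ α → τ ⊢* ts ∶ αs → τ ⊢* (t ∷ ts) ∶ (α ∷ αs)

  ArgFilter : (Sig → Ty B) → Set
  ArgFilter type = (f : Sig) → AF (type f)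

  typeπ : (type : Sig → Ty B) → ArgFilter type → Sig → Ty B
  typeπ type π f with π f
  ... | proj i _ = type f
  ... | keep is  = arrows (map (lookup (argTys (type f))) is) (base (target (type f)))

  lams : List V → Tm → Tm
  lams xs (tm ys a us) = tm (xs ++ ys) a us

  -- π on terms (arguments are filtered first, then selected; this is the
  -- same as selecting first and filtering the selected arguments).
  -- Out-of-range indices cannot occur for well-typed terms; defaults are arbitrary.
  module Filter (type : Sig → Ty B) (π : ArgFilter type) where
    applyAF : List V → (f : Sig) → AF (type f) → List Tm → Tm
    applyAF xs f (proj i _) us with nth us (toℕ i)
    ... | just u  = lams xs u
    ... | nothing = tm xs (fun f) []
    applyAF xs f (keep is) us = tm xs (fun f) (mapMaybe (λ i → nth us (toℕ i)) is)

    mutual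
      filt : Tm → Tm
      filt (tm xs (var x) ts) = tm xs (var x) (filts ts)
      filt (tm xs (fun f) ts) = applyAF xs f (π f) (filts ts)

      filts : List Tm → List Tm
      filts []       = []
      filts (t ∷ ts) = filt t ∷ filts ts

-- At a symbol f of type
-- α₁ → ⋯ → αₙ → β, the filtered arguments keep their types αᵢ. If π(f) = i,
-- then αᵢ = β is basic, so πtᵢ has no binders of its own and prefixing the
-- outer binders gives the original type. If π(f) = [i₁,…,iₖ], the selected
-- arguments fit type_π(f) = α_{i₁} → ⋯ → α_{iₖ} → β exactly.
module Submission where

open import Defs
open import Data.Fin using (Fin; toℕ; zero; suc)
open import Data.List using (List; []; _∷_; length; lookup; map; mapMaybe)
open import Data.List.Properties using (++-identityʳ)
open import Data.Maybe using (just)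
open import Data.Product using (∃-syntax; _×_; _,_)
open import Relation.Binary.PropositionalEquality

argTys-arrows : {B : Set} (αs : List (Ty B)) (b : B) → argTys (arrows αs (base b)) ≡ αs
argTys-arrows []       b = refl
argTys-arrows (α ∷ αs) b = cong (α ∷_) (argTys-arrows αs b)

target-arrows : {B : Set} (αs : List (Ty B)) (b : B) → target (arrows αs (base b)) ≡ b
target-arrows []       b = refl
target-arrows (α ∷ αs) b = target-arrows αs b

argTys-target-of : {B : Set} {τ : Ty B} {αs : List (Ty B)} {b : B} →
                   τ ≡ arrows αs (base b) → argTys τ ≡ αs × target τ ≡ b
argTys-target-of {αs = αs} {b} refl = argTys-arrows αs b , target-arrows αs b

module Typing {B Sig V : Set} (typeV : V → Ty B) {τ : Sig → Ty B} where
  open HRS {Sig = Sig} typeV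

  nth-typed : ∀ {us αs} → τ ⊢* us ∶ αs → (i : Fin (length αs)) →
              ∃[ u ] nth us (toℕ i) ≡ just u × τ ⊢ u ∶ lookup αs i
  nth-typed (⊢u ∷ ⊢us) zero    = _ , refl , ⊢u
  nth-typed (⊢u ∷ ⊢us) (suc i) = nth-typed ⊢us i

  select-typed : ∀ {us αs} → τ ⊢* us ∶ αs → (is : List (Fin (length αs))) →
                 τ ⊢* mapMaybe (λ i → nth us (toℕ i)) is ∶ map (lookup αs) is
  select-typed ⊢us []       = []
  select-typed ⊢us (i ∷ is) with nth-typed ⊢us i
  ... | _ , nth≡u , ⊢u rewrite nth≡u = ⊢u ∷ select-typed ⊢us is

  -- A term of basic type has no binders, so lams only contributes the new ones.
  lams-typed : ∀ {u α b} xs → τ ⊢ u ∶ α → α ≡ base b →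
               τ ⊢ lams xs u ∶ arrows (map typeV xs) (base b)
  lams-typed {tm []      a vs} xs (tm-ty ⊢vs e) refl rewrite ++-identityʳ xs = tm-ty ⊢vs e
  lams-typed {tm (_ ∷ _) a vs} xs (tm-ty ⊢vs e) ()

module Filtering {B Sig V : Set} (typeV : V → Ty B) (type : Sig → Ty B)
                 (π : HRS.ArgFilter typeV type) where
  open HRS {Sig = Sig} typeV
  open Filter type π
  open Typing typeV {typeπ type π}

  typeπ-keep : ∀ f is → π f ≡ keep is →
               typeπ type π f ≡ arrows (map (lookup (argTys (type f))) is) (base (target (type f)))
  typeπ-keep f is πf≡ with π f
  typeπ-keep f is refl | .(keep is) = refl

  applyAF-typed : ∀ {us} xs f → typeπ type π ⊢* us ∶ argTys (type f) →
                  typeπ type π ⊢ applyAF xs f (π f) us ∶ arrows (map typeV xs) (base (target (type f)))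
  applyAF-typed xs f ⊢us with π f in πf≡
  ... | proj i αᵢ≡β with nth-typed ⊢us i
  ...   | _ , nth≡u , ⊢u rewrite nth≡u = lams-typed xs ⊢u αᵢ≡β
  applyAF-typed xs f ⊢us | keep is = tm-ty (select-typed ⊢us is) (typeπ-keep f is πf≡)

  mutual
    filt-typed : ∀ {t α} → type ⊢ t ∶ α → typeπ type π ⊢ filt t ∶ α
    filt-typed {tm xs (var x) ts} (tm-ty ⊢ts e) = tm-ty (filts-typed ⊢ts) e
    filt-typed {tm xs (fun f) ts} (tm-ty ⊢ts e) with argTys-target-of e
    ... | refl , refl = applyAF-typed xs f (filts-typed ⊢ts)

    filts-typed : ∀ {ts αs} → type ⊢* ts ∶ αs → typeπ type π ⊢* filts ts ∶ αs
    filts-typed []         = []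
    filts-typed (⊢t ∷ ⊢ts) = filt-typed ⊢t ∷ filts-typed ⊢ts

theorem1 : {B Sig V : Set} (typeV : V → Ty B) (type : Sig → Ty B)
    (π : HRS.ArgFilter typeV type) (t : HRS.Tm typeV) (α : Ty B) →
    HRS._⊢_∶_ typeV type t α →
    HRS._⊢_∶_ typeV (HRS.typeπ typeV type π) (HRS.Filter.filt typeV type π t) α
theorem1 typeV type π t α = Filtering.filt-typed typeV type π
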